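{- Let $h>0$ and consider the balancing formula of height $h$ on variables $x_0,\dots,x_{2^h-1}$. An assignment $a_0,\dots,a_{2^h-1}\in\{0,1\}$ to $x_0,\dots,x_{2^h-1}$ is accepted by the formula if and only if for every $0<k\le h$ and every $0\le i<2^{h-k}$, the number of $1$ values among $a_{i2^k},\dots,a_{(i+1)2^k-1}$ is either $0$, $2^k$ or $2^{k-1}$.
   Context: Alphabet $\Sigma=\{0,1,P,F\}$. The balancing gate takes two inputs from $\Sigma$ and outputs: $0$ on $(0,0)$; $1$ on $(1,1)$; $P$ on $(1,0)$, $(0,1)$ and $(P,P)$; and $F$ on every other input pair. The balancing formula of height $h$ is the full balanced binary tree of height $h$ whose $2^h$ leaves are the variables $x_0,\dots,x_{2^h-1}$ in left-to-right order and whose internal vertices are all balancing gates; values are computed bottom-up, and an assignment is accepted if the value at the root is not $F$. -}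

module Defs where

open import Data.Nat using (ℕ; zero; suc; _+_; _*_; _^_)
open import Data.Bool using (Bool; true; false)
open import Data.Vec using (Vec; []; _∷_; take; drop; map)
import Data.Vec
open import Data.Empty using (⊥)
open import Relation.Binary.PropositionalEquality using (_≡_)

data Sym : Set where
  𝟘 𝟙 P F : Sym

bal : Sym → Sym → Sym
bal 𝟘 𝟘 = 𝟘
bal 𝟙 𝟙 = 𝟙
bal 𝟙 𝟘 = P
bal 𝟘 𝟙 = P
bal P P = P
bal _ _ = F

-- Note 2^(suc h) = 2^h + (2^h + 0)
-- definitionally: the left subtree gets the first 2^h leaves, the right
-- subtree the next 2^h leaves.
evalBal : (h : ℕ) → Vec Sym (2 ^ h) → Sym
evalBal zero (x ∷ []) = x
evalBal (suc h) xs =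
  bal (evalBal h (take (2 ^ h) xs))
      (evalBal h (take (2 ^ h) (drop (2 ^ h) xs)))

toSym : Bool → Sym
toSym false = 𝟘
toSym true  = 𝟙

Accepted : (h : ℕ) → Vec Bool (2 ^ h) → Set
Accepted h a = evalBal h (map toSym a) ≡ F → ⊥

open import Data.List as L using (List)

ones : List Bool → ℕ
ones L.[] = 0
ones (true  L.∷ bs) = suc (ones bs)
ones (false L.∷ bs) = ones bs

blockOnes : {n : ℕ} → Vec Bool n → (k i : ℕ) → ℕ
blockOnes a k i = ones (L.take (2 ^ k) (L.drop (i * 2 ^ k) (Data.Vec.toList a)))

-- The proof tracks what the value of a subtree says about its leaves.  Call a
-- symbol s a description of a height-h subtree with n ones ('Describes h s n')
-- if s = 0 and n = 0, or s = 1 and n = 2^h, or s = P, h > 0 and n = 2^(h-1);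
-- F describes nothing.  Two facts about a single gate whose inputs describe
-- their subtrees carry the argument:
--   * if the gate does not output F, its output describes the whole tree;
--   * if the total count of ones is balanced, the gate does not output F.
-- Splitting a tree into its two halves, the aligned blocks of the whole tree are
-- the blocks of the halves together with the whole leaf sequence, so the block
-- condition of height h+1 is the block conditions of both halves plus balance of
-- the total count.  Induction on h then proves both directions, each time
-- carrying the statement that the root value describes the count of ones.
module Submission where

open import Defs
open import Data.Nat using (ℕ; zero; suc; _<_; _≤_; _∸_; _^_; _+_; _*_; z≤n; s≤s; _<?_)
open import Data.Nat.Properties
open import Data.Bool using (Bool; true; false)
open import Data.Vec using (Vec; []; _∷_; take; drop; map; toList)
import Data.Vec.Properties as Vecₚ
open import Data.List as L using (List; length; _++_)
import Data.List.Properties as Listₚ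
open import Data.Sum using (_⊎_; inj₁; inj₂)
open import Data.Product using (_×_; _,_; proj₁; proj₂; ∃-syntax)
open import Data.Empty using (⊥; ⊥-elim)
open import Relation.Nullary using (¬_; yes; no)
open import Relation.Binary.PropositionalEquality
open import Function.Bundles using (_⇔_; mk⇔; Equivalence)

block : {A : Set} → ℕ → ℕ → List A → List A
block b j l = L.take b (L.drop (j * b) l)

take-++ˡ : {A : Set} (n : ℕ) (l r : List A) → n ≤ length l → L.take n (l ++ r) ≡ L.take n l
take-++ˡ zero    l         r _         = refl
take-++ˡ (suc n) (x L.∷ l) r (s≤s n≤) = cong (x L.∷_) (take-++ˡ n l r n≤)

segment-++ˡ : {A : Set} (n b : ℕ) (l r : List A) → n + b ≤ length l →
              L.take b (L.drop n (l ++ r)) ≡ L.take b (L.drop n l)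
segment-++ˡ zero    b l         r n+b≤ = take-++ˡ b l r n+b≤
segment-++ˡ (suc n) b (x L.∷ l) r (s≤s n+b≤) = segment-++ˡ n b l r n+b≤

drop-++ʳ : {A : Set} (n : ℕ) (l r : List A) → L.drop (length l + n) (l ++ r) ≡ L.drop n r
drop-++ʳ n L.[]      r = refl
drop-++ʳ n (x L.∷ l) r = drop-++ʳ n l r

block-++ˡ : {A : Set} (b m j : ℕ) (l r : List A) → length l ≡ m * b → j < m →
            block b j (l ++ r) ≡ block b j l
block-++ˡ b m j l r len j<m = segment-++ˡ (j * b) b l r fits
  where
    fits : j * b + b ≤ length l
    fits = subst₂ _≤_ (+-comm b (j * b)) (sym len) (*-monoˡ-≤ b j<m)

block-++ʳ : {A : Set} (b m j : ℕ) (l r : List A) → length l ≡ m * b →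
            block b (m + j) (l ++ r) ≡ block b j r
block-++ʳ b m j l r len = begin
  L.take b (L.drop ((m + j) * b) (l ++ r))
    ≡⟨ cong (λ n → L.take b (L.drop n (l ++ r))) offset ⟩
  L.take b (L.drop (length l + j * b) (l ++ r))
    ≡⟨ cong (L.take b) (drop-++ʳ (j * b) l r) ⟩
  block b j r ∎
  where
    open ≡-Reasoning
    offset : (m + j) * b ≡ length l + j * b
    offset = trans (*-distribʳ-+ b m j) (cong (_+ j * b) (sym len))

ones-++ : (l r : List Bool) → ones (l ++ r) ≡ ones l + ones r
ones-++ L.[]          r = refl
ones-++ (true L.∷ l)  r = cong suc (ones-++ l r)
ones-++ (false L.∷ l) r = ones-++ l r

split-index : (m i : ℕ) → i < 2 * m → i < m ⊎ ∃[ j ] (j < m × m + j ≡ i)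
split-index m i i<2m with i <? m
... | yes i<m = inj₁ i<m
... | no  i≮m = inj₂ (i ∸ m , j<m , m+j≡i)
  where
    m+j≡i : m + (i ∸ m) ≡ i
    m+j≡i = m+[n∸m]≡n (≮⇒≥ i≮m)
    j<m : i ∸ m < m
    j<m = +-cancelˡ-< m (i ∸ m) m
            (subst₂ _<_ (sym m+j≡i) (cong (m +_) (+-identityʳ m)) i<2m)

blocks-cover : (h k : ℕ) → k ≤ h → 2 ^ h ≡ 2 ^ (h ∸ k) * 2 ^ k
blocks-cover h k k≤h = begin
  2 ^ h               ≡⟨ cong (2 ^_) (sym (m∸n+n≡m k≤h)) ⟩
  2 ^ (h ∸ k + k)     ≡⟨ ^-distribˡ-+-* 2 (h ∸ k) k ⟩
  2 ^ (h ∸ k) * 2 ^ k ∎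
  where open ≡-Reasoning

blocks-double : (h k : ℕ) → k ≤ h → 2 ^ (suc h ∸ k) ≡ 2 * 2 ^ (h ∸ k)
blocks-double h k k≤h = cong (2 ^_) (+-∸-assoc 1 k≤h)

Balanced : ℕ → ℕ → Set
Balanced k n = n ≡ 0 ⊎ n ≡ 2 ^ k ⊎ n ≡ 2 ^ (k ∸ 1)

Blocks : (h : ℕ) → Vec Bool (2 ^ h) → Set
Blocks h a = (k i : ℕ) → 0 < k → k ≤ h → i < 2 ^ (h ∸ k) → Balanced k (blockOnes a k i)

balanced-multiple : (h c : ℕ) → Balanced (2 + h) (c * 2 ^ h) → c ≡ 0 ⊎ c ≡ 4 ⊎ c ≡ 2
balanced-multiple h c (inj₁ none) = inj₁ (*-cancelʳ-≡ c 0 (2 ^ h) {{m^n≢0 2 h}} none)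
balanced-multiple h c (inj₂ (inj₁ all)) =
  inj₂ (inj₁ (*-cancelʳ-≡ c 4 (2 ^ h) {{m^n≢0 2 h}} (trans all (sym (*-assoc 2 2 (2 ^ h))))))
balanced-multiple h c (inj₂ (inj₂ half)) = inj₂ (inj₂ (*-cancelʳ-≡ c 2 (2 ^ h) {{m^n≢0 2 h}} half))

quarter-unbalanced : (h : ℕ) → ¬ Balanced (2 + h) (1 * 2 ^ h)
quarter-unbalanced h b with balanced-multiple h 1 b
... | inj₁ ()
... | inj₂ (inj₁ ())
... | inj₂ (inj₂ ())

three-quarters-unbalanced : (h : ℕ) → ¬ Balanced (2 + h) (3 * 2 ^ h)
three-quarters-unbalanced h b with balanced-multiple h 3 b
... | inj₁ ()
... | inj₂ (inj₁ ())
... | inj₂ (inj₂ ())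

Describes : ℕ → Sym → ℕ → Set
Describes h       𝟘 n = n ≡ 0
Describes h       𝟙 n = n ≡ 2 ^ h
Describes zero    P n = ⊥
Describes (suc h) P n = n ≡ 2 ^ h
Describes h       F n = ⊥

describes⇒accepting : ∀ {h s n} → Describes h s n → s ≡ F → ⊥
describes⇒accepting d refl = d

describes⇒balanced : ∀ {h s n} → Describes (suc h) s n → Balanced (suc h) n
describes⇒balanced {s = 𝟘} none = inj₁ none
describes⇒balanced {s = 𝟙} all  = inj₂ (inj₁ all)
describes⇒balanced {s = P} half = inj₂ (inj₂ half)

leaf-describes : (b : Bool) → Describes 0 (toSym b) (ones (b L.∷ L.[]))
leaf-describes true  = refl
leaf-describes false = refl

twice : (x : ℕ) → x + x ≡ 2 * x
twice x = cong (x +_) (sym (+-identityʳ x))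

inputs-accepting : (s t : Sym) → (bal s t ≡ F → ⊥) → (s ≡ F → ⊥) × (t ≡ F → ⊥)
inputs-accepting s t accepting = left-ok s t accepting , right-ok s t accepting
  where
    left-ok : (s t : Sym) → (bal s t ≡ F → ⊥) → s ≡ F → ⊥
    left-ok F t accepting refl = accepting refl
    right-ok : (s t : Sym) → (bal s t ≡ F → ⊥) → t ≡ F → ⊥
    right-ok 𝟘 F accepting refl = accepting refl
    right-ok 𝟙 F accepting refl = accepting refl
    right-ok P F accepting refl = accepting refl
    right-ok F F accepting refl = accepting refl

gate-describes : ∀ {h s t n m} → Describes h s n → Describes h t m → (bal s t ≡ F → ⊥) →
                 Describes (suc h) (bal s t) (n + m)
gate-describes {h} {𝟘} {𝟘} refl refl _ = refl
gate-describes {h} {𝟙} {𝟙} refl refl _ = twice (2 ^ h)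
gate-describes {h} {𝟙} {𝟘} refl refl _ = +-identityʳ (2 ^ h)
gate-describes {h} {𝟘} {𝟙} refl refl _ = refl
gate-describes {suc h} {P} {P} refl refl _ = twice (2 ^ h)
gate-describes {zero} {P} ()
gate-describes {h} {𝟘} {P} _ _ fails = ⊥-elim (fails refl)
gate-describes {h} {𝟙} {P} _ _ fails = ⊥-elim (fails refl)
gate-describes {h} {P} {𝟘} _ _ fails = ⊥-elim (fails refl)
gate-describes {h} {P} {𝟙} _ _ fails = ⊥-elim (fails refl)
gate-describes {s = F} ()
gate-describes {s = 𝟘} {F} _ ()
gate-describes {s = 𝟙} {F} _ ()
gate-describes {s = P} {F} _ ()

-- A gate over described subtrees does not fail when the total count is
-- balanced: the failing mixed inputs (0,P), (P,0), (1,P), (P,1) have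
-- counts 2^(h-1) or 3·2^(h-1) on 2^(h+1) leaves.
gate-accepts : ∀ {h s t n m} → Describes h s n → Describes h t m → Balanced (suc h) (n + m) →
               bal s t ≡ F → ⊥
gate-accepts {s = 𝟘} {𝟘} _ _ _ ()
gate-accepts {s = 𝟙} {𝟙} _ _ _ ()
gate-accepts {s = 𝟙} {𝟘} _ _ _ ()
gate-accepts {s = 𝟘} {𝟙} _ _ _ ()
gate-accepts {s = P} {P} _ _ _ ()
gate-accepts {suc h} {s = 𝟘} {P} refl refl b _ =
  quarter-unbalanced h (subst (Balanced (2 + h)) (sym (*-identityˡ (2 ^ h))) b)
gate-accepts {suc h} {s = P} {𝟘} refl refl b _ = quarter-unbalanced h b
gate-accepts {suc h} {s = 𝟙} {P} refl refl b _ =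
  three-quarters-unbalanced h (subst (Balanced (2 + h)) (+-comm (2 ^ suc h) (2 ^ h)) b)
gate-accepts {suc h} {s = P} {𝟙} refl refl b _ = three-quarters-unbalanced h b
gate-accepts {zero} {s = P} ()
gate-accepts {zero} {t = P} _ ()
gate-accepts {s = F} ()
gate-accepts {t = F} _ ()

value : (h : ℕ) → Vec Bool (2 ^ h) → Sym
value h a = evalBal h (map toSym a)

count : {n : ℕ} → Vec Bool n → ℕ
count a = ones (toList a)

toList-split : {A : Set} (m : ℕ) {n : ℕ} (xs : Vec A (m + n)) →
               toList xs ≡ toList (take m xs) ++ toList (drop m xs)
toList-split m xs =
  trans (cong toList (sym (Vecₚ.take++drop≡id m xs))) (Vecₚ.toList-++ (take m xs) (drop m xs))

toList-empty : {A : Set} (xs : Vec A 0) → toList xs ≡ L.[]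
toList-empty [] = refl

module Halves (h : ℕ) (a : Vec Bool (2 ^ suc h)) where

  left right : Vec Bool (2 ^ h)
  left  = take (2 ^ h) a
  right = take (2 ^ h) (drop (2 ^ h) a)

  leaves : toList a ≡ toList left ++ toList right
  leaves = begin
    toList a                                  ≡⟨ toList-split (2 ^ h) a ⟩
    toList left ++ toList (drop (2 ^ h) a)    ≡⟨ cong (toList left ++_) (toList-split (2 ^ h) (drop (2 ^ h) a)) ⟩
    toList left ++ (toList right ++ toList (drop (2 ^ h) (drop (2 ^ h) a)))
      ≡⟨ cong (λ l → toList left ++ (toList right ++ l)) (toList-empty _) ⟩
    toList left ++ (toList right ++ L.[])     ≡⟨ cong (toList left ++_) (Listₚ.++-identityʳ _) ⟩
    toList left ++ toList right               ∎
    where open ≡-Reasoning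

  count-split : count a ≡ count left + count right
  count-split = trans (cong ones leaves) (ones-++ (toList left) (toList right))

  value-split : value (suc h) a ≡ bal (value h left) (value h right)
  value-split = cong₂ bal
    (cong (evalBal h) (Vecₚ.take-map toSym (2 ^ h) a))
    (cong (evalBal h) (trans (cong (take (2 ^ h)) (Vecₚ.drop-map toSym (2 ^ h) a))
                             (Vecₚ.take-map toSym (2 ^ h) (drop (2 ^ h) a))))

  root-describes : Describes h (value h left) (count left) → Describes h (value h right) (count right) →
                   (bal (value h left) (value h right) ≡ F → ⊥) → Describes (suc h) (value (suc h) a) (count a)
  root-describes dL dR accepting =
    subst₂ (Describes (suc h)) (sym value-split) (sym count-split) (gate-describes dL dR accepting)

  left-length : ∀ k → k ≤ h → length (toList left) ≡ 2 ^ (h ∸ k) * 2 ^ k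
  left-length k k≤h = trans (Vecₚ.length-toList left) (blocks-cover h k k≤h)

  block-left : ∀ k i → k ≤ h → i < 2 ^ (h ∸ k) → blockOnes a k i ≡ blockOnes left k i
  block-left k i k≤h i<m = cong ones (trans (cong (block (2 ^ k) i) leaves)
    (block-++ˡ (2 ^ k) (2 ^ (h ∸ k)) i (toList left) (toList right) (left-length k k≤h) i<m))

  block-right : ∀ k j → k ≤ h → blockOnes a k (2 ^ (h ∸ k) + j) ≡ blockOnes right k j
  block-right k j k≤h = cong ones (trans (cong (block (2 ^ k) (2 ^ (h ∸ k) + j)) leaves)
    (block-++ʳ (2 ^ k) (2 ^ (h ∸ k)) j (toList left) (toList right) (left-length k k≤h)))

  block-whole : blockOnes a (suc h) 0 ≡ count a
  block-whole = cong ones (Listₚ.take-all (2 ^ suc h) (toList a)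
                             (≤-reflexive (Vecₚ.length-toList a)))

  blocks-split : Blocks (suc h) a ⇔ (Blocks h left × Blocks h right × Balanced (suc h) (count a))
  blocks-split = mk⇔ to from
    where
      to : Blocks (suc h) a → Blocks h left × Blocks h right × Balanced (suc h) (count a)
      to c = blocksˡ , blocksʳ , subst (Balanced (suc h)) block-whole (c (suc h) 0 (s≤s z≤n) ≤-refl one-block)
        where
          one-block : 0 < 2 ^ (suc h ∸ suc h)
          one-block = m^n>0 2 (h ∸ h)
          blocksˡ : Blocks h left
          blocksˡ k i 0<k k≤h i<m = subst (Balanced k) (block-left k i k≤h i<m)
            (c k i 0<k (m≤n⇒m≤1+n k≤h)
               (subst (i <_) (sym (blocks-double h k k≤h)) (≤-trans i<m (m≤m+n _ _))))
          blocksʳ : Blocks h right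
          blocksʳ k j 0<k k≤h j<m = subst (Balanced k) (block-right k j k≤h)
            (c k (2 ^ (h ∸ k) + j) 0<k (m≤n⇒m≤1+n k≤h)
               (subst (2 ^ (h ∸ k) + j <_) (sym (blocks-double h k k≤h)) (+-monoʳ-< (2 ^ (h ∸ k)) j<m')))
            where
              j<m' : j < 2 ^ (h ∸ k) + 0
              j<m' = subst (j <_) (sym (+-identityʳ _)) j<m

      from : Blocks h left × Blocks h right × Balanced (suc h) (count a) → Blocks (suc h) a
      from (cL , cR , total) k i 0<k k≤1+h i<2m with m≤n⇒m<n∨m≡n k≤1+h
      ... | inj₂ refl = subst (λ i → Balanced (suc h) (blockOnes a (suc h) i)) (sym i≡0)
                          (subst (Balanced (suc h)) (sym block-whole) total)
        where
          i≡0 : i ≡ 0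
          i≡0 = n<1⇒n≡0 (subst (λ e → i < 2 ^ e) (n∸n≡0 h) i<2m)
      ... | inj₁ (s≤s k≤h) with split-index (2 ^ (h ∸ k)) i (subst (i <_) (blocks-double h k k≤h) i<2m)
      ...   | inj₁ i<m = subst (Balanced k) (sym (block-left k i k≤h i<m)) (cL k i 0<k k≤h i<m)
      ...   | inj₂ (j , j<m , refl) = subst (Balanced k) (sym (block-right k j k≤h)) (cR k j 0<k k≤h j<m)

blocks⇒describes : (h : ℕ) (a : Vec Bool (2 ^ h)) → Blocks h a → Describes h (value h a) (count a)
blocks⇒describes zero    (b ∷ []) _ = leaf-describes b
blocks⇒describes (suc h) a blocks = root (Equivalence.to blocks-split blocks)
  where
    open Halves h a
    root : Blocks h left × Blocks h right × Balanced (suc h) (count a) →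
           Describes (suc h) (value (suc h) a) (count a)
    root (cL , cR , total) =
      root-describes dL dR (gate-accepts dL dR (subst (Balanced (suc h)) count-split total))
      where
        dL : Describes h (value h left) (count left)
        dL = blocks⇒describes h left cL
        dR : Describes h (value h right) (count right)
        dR = blocks⇒describes h right cR

accepted⇒blocks : (h : ℕ) (a : Vec Bool (2 ^ h)) → Accepted h a →
                  Blocks h a × Describes h (value h a) (count a)
accepted⇒blocks zero (b ∷ []) _ = (λ { k i () z≤n _ }) , leaf-describes b
accepted⇒blocks (suc h) a accepted =
  Equivalence.from blocks-split (proj₁ halfL , proj₁ halfR , describes⇒balanced d) , d
  where
    open Halves h a
    accepting : bal (value h left) (value h right) ≡ F → ⊥
    accepting fails = accepted (trans value-split fails)
    halfL : Blocks h left × Describes h (value h left) (count left)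
    halfL = accepted⇒blocks h left (proj₁ (inputs-accepting _ _ accepting))
    halfR : Blocks h right × Describes h (value h right) (count right)
    halfR = accepted⇒blocks h right (proj₂ (inputs-accepting _ _ accepting))
    d : Describes (suc h) (value (suc h) a) (count a)
    d = root-describes (proj₂ halfL) (proj₂ halfR) accepting

lemma7p2 : (h : ℕ) → 0 < h → (a : Vec Bool (2 ^ h)) →
    Accepted h a ⇔
      ((k i : ℕ) → 0 < k → k ≤ h → i < 2 ^ (h ∸ k) →
        (blockOnes a k i ≡ 0 ⊎ blockOnes a k i ≡ 2 ^ k ⊎ blockOnes a k i ≡ 2 ^ (k ∸ 1)))
lemma7p2 h _ a = mk⇔
  (λ accepted → proj₁ (accepted⇒blocks h a accepted))
  (λ blocks → describes⇒accepting (blocks⇒describes h a blocks))
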